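{- Consider strings of length $n$ over the alphabet $\{\texttt{o},\texttt{<},\texttt{>}\}$, where $\texttt{o}$ denotes an empty place and $\texttt{<}$, $\texttt{>}$ denote an element oriented to the left, resp. right; let $k$ be the number of elements (non-$\texttt{o}$ characters), $1\le k\le n$. Run the following procedure on such a string: 1. Output the current string. Set the active element to be the rightmost element. 2. If the active element faces an adjacent empty place (i.e. the substring is $\texttt{>o}$ with the active element being the $\texttt{>}$, or $\texttt{o<}$ with the active element being the $\texttt{<}$), swap it with that empty place; go to step 1. 3. If the active element faces left and, letting $p$ be the nearest empty place to its left, all places strictly between $p$ and the active element are occupied by elements facing left, then move the active element (keeping its orientation) to $p$, leaving its old place empty, and change the orientation of all elements strictly between to right ($\texttt{>}$); go to step 1. 4. If the active element faces right and, letting $p$ be the nearest empty place to its right, all places strictly between are occupied by elements facing right, then move the active element (keeping its orientation) to $p$, leaving its old place empty; go to step 1. 5. Otherwise the active element reverses its orientation. If there is no element to the left of the active element, the procedure terminates (step 6). Otherwise the nearest element to the left of the active element becomes the active element; go to step 2. Then: (a) If the initial string is $\texttt{>}^k\texttt{o}^{n-k}$, the procedure terminates, the outputs, read with orientations ignored (i.e. as placements of $k$ identical elements in $n$ places), run through all $\binom nk$ placements exactly once, and the last output has the form $\texttt{o}^{n-k}\texttt{>}w$ where $w$ is some string of length $k-1$ over $\{\texttt{<},\texttt{>}\}$. (b) If the initial string is the negative (swap every $\texttt{<}$ with $\texttt{>}$, keep $\texttt{o}$) of the last output in case (a), i.e. of the form $\texttt{o}^{n-k}\texttt{<}\bar w$,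 the procedure terminates, the outputs with orientations ignored run through all $\binom nk$ placements exactly once, and the last output is $\texttt{<}^k\texttt{o}^{n-k}$.
   Context: Here $\texttt{x}^m$ denotes $m$ consecutive copies of the character $\texttt{x}$. Two outputs with the same positions of elements but different orientations count as the same placement. -}

module Defs where

open import Data.Nat using (ℕ; zero; suc; _+_; _∸_)
open import Data.Bool using (Bool; true; false; if_then_else_)
open import Data.List using (List; []; _∷_; map; upTo; foldr; length)
import Data.Maybe as Maybe
open import Data.Maybe using (Maybe; just; nothing)
open import Data.Product using (_×_; ∃-syntax)
open import Relation.Binary.PropositionalEquality using (_≡_)
open import Data.List.Relation.Unary.Unique.Propositional using (Unique)
open import Data.List.Membership.Propositional using (_∈_)
open import Function.Bundles using (_⇔_)

-- o = empty place, L = element facing left ('<'), R = element facing right ('>')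
data Cell : Set where
  o L R : Cell

-- Positions are 0-based indices; out-of-range gives nothing.
cellAt : List Cell → ℕ → Maybe Cell
cellAt []      _       = nothing
cellAt (c ∷ s) zero    = just c
cellAt (c ∷ s) (suc j) = cellAt s j

isEmptyAt : List Cell → ℕ → Bool
isEmptyAt s j with cellAt s j
... | just o = true
... | _      = false

isElemAt : List Cell → ℕ → Bool
isElemAt s j with cellAt s j
... | just L = true
... | just R = true
... | _      = false

isLAt : List Cell → ℕ → Bool
isLAt s j with cellAt s j
... | just L = true
... | _      = false

isRAt : List Cell → ℕ → Bool
isRAt s j with cellAt s j
... | just R = true
... | _      = false

set : List Cell → ℕ → Cell → List Cell
set []      _       _ = []
set (c ∷ s) zero    d = d ∷ s
set (c ∷ s) (suc j) d = c ∷ set s j d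

flip : Cell → Cell
flip o = o
flip L = R
flip R = L

neg : List Cell → List Cell
neg = map flip

prevElem : List Cell → ℕ → Maybe ℕ
prevElem s zero    = nothing
prevElem s (suc j) = if isElemAt s j then just j else prevElem s j

prevEmpty : List Cell → ℕ → Maybe ℕ
prevEmpty s zero    = nothing
prevEmpty s (suc j) = if isEmptyAt s j then just j else prevEmpty s j

searchEmpty : List Cell → ℕ → ℕ → Maybe ℕ
searchEmpty s j zero    = nothing
searchEmpty s j (suc m) = if isEmptyAt s j then just j else searchEmpty s (suc j) m

nextEmpty : List Cell → ℕ → Maybe ℕ
nextEmpty s i = searchEmpty s (suc i) (length s ∸ suc i)

allB : {A : Set} → (A → Bool) → List A → Bool
allB p []       = true
allB p (x ∷ xs) = if p x then allB p xs else false

between : ℕ → ℕ → List ℕ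
between p i = map (λ t → suc (p + t)) (upTo (i ∸ suc p))

-- result of executing steps 2-5 once with active element at position i
data Outcome : Set where
  moved    : List Cell → Outcome               -- a move happened: go to step 1
  reversed : List Cell → Maybe ℕ → Outcome     -- step 5: new string, new active element (nothing = terminate)
  stuck    : Outcome                           -- active position is not an element (cannot happen)

step5 : List Cell → ℕ → Cell → Outcome
step5 s i c = let s' = set s i (flip c) in reversed s' (prevElem s' i)

stepL3 : List Cell → ℕ → Outcome
stepL3 s i with prevEmpty s i
... | nothing = step5 s i L
... | just p  = if allB (isLAt s) (between p i)
                then moved (foldr (λ j t → set t j R) (set (set s p L) i o) (between p i))
                else step5 s i L

stepL : List Cell → ℕ → Outcome
stepL s zero    = stepL3 s zero
stepL s (suc j) = if isEmptyAt s j then moved (set (set s j L) (suc j) o) else stepL3 s (suc j)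

stepR4 : List Cell → ℕ → Outcome
stepR4 s i with nextEmpty s i
... | nothing = step5 s i R
... | just p  = if allB (isRAt s) (between i p)
                then moved (set (set s p R) i o)
                else step5 s i R

stepR : List Cell → ℕ → Outcome
stepR s i = if isEmptyAt s (suc i) then moved (set (set s (suc i) R) i o) else stepR4 s i

step : List Cell → ℕ → Outcome
step s i with cellAt s i
... | just L = stepL s i
... | just R = stepR s i
... | _      = stuck

-- Run the procedure with a fuel bound; `just outs` means it terminated
-- (within the fuel) producing exactly the outputs `outs`, in order.
mutual
  output : ℕ → List Cell → Maybe (List (List Cell))
  output f s with prevElem s (length s)
  ... | nothing = nothing
  ... | just i  = Maybe.map (s ∷_) (active f s i)

  active : ℕ → List Cell → ℕ → Maybe (List (List Cell))
  active zero    s i = nothing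
  active (suc f) s i with step s i
  ... | moved s'             = output f s'
  ... | reversed s' nothing  = just []
  ... | reversed s' (just j) = active f s' j
  ... | stuck                = nothing

RunsTo : List Cell → List (List Cell) → Set
RunsTo s outs = ∃[ f ] output f s ≡ just outs

-- placement = string with orientations ignored (true = occupied)
shape : List Cell → List Bool
shape = map λ { o → false ; _ → true }

ones : List Bool → ℕ
ones []          = 0
ones (true ∷ b)  = suc (ones b)
ones (false ∷ b) = ones b

IsPlacement : ℕ → ℕ → List Bool → Set
IsPlacement n k b = (length b ≡ n) × (ones b ≡ k)

AllPlacementsOnce : ℕ → ℕ → List (List Cell) → Set
AllPlacementsOnce n k outs =
  Unique (map shape outs) × (∀ b → (b ∈ map shape outs) ⇔ IsPlacement n k b)

-- An R-block >^(a+1) o^e <u or an L-block o^e <u (u without empty places; the tail <u is optional in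
-- an R-block) is run behind an arbitrary prefix, which it leaves alone until it hands the active element
-- back to it. The outputs of a block split by its first place: an R-block first runs the block after its
-- first > with that > in place, then the > slides or jumps right and the block after the now empty first
-- place is run; an L-block does the same in the other order, its second element sliding or jumping left
-- into the first place. So, by Pascal's rule, every placement is listed exactly once. The second block
-- is assembled from negatives of the ending of the first, so the induction on the length of the block
-- proves a duality along with it: if the run of a block T ends in E, then the run started from the
-- negative of E ends in the negative of T. Statements (a) and (b) are this for T = >^k o^(n-k).

module Submission where

open import Defs
open import Data.Nat using (ℕ; zero; suc; _+_; _∸_; _≤_; _<_; s≤s; z≤n)
open import Data.Nat.Properties
open import Data.Bool using (Bool; true; false; if_then_else_)
open import Data.Empty using (⊥)
open import Data.List using (List; []; _∷_; _++_; _∷ʳ_; map; replicate; length; last; upTo; foldr)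
open import Data.List.Properties
  using (length-++; ++-assoc; ++-identityʳ; length-replicate; map-++; map-cong; map-∘; map-id; map-replicate;
         length-map; last-map; upTo-∷ʳ; foldr-∷ʳ; ∷-injectiveʳ)
open import Data.List.Relation.Unary.All using (All; []; _∷_)
import Data.List.Relation.Unary.All as All
import Data.List.Relation.Unary.All.Properties as All
open import Data.List.Relation.Unary.Any using (here; there)
open import Data.List.Relation.Unary.Unique.Propositional using (Unique; []; _∷_)
import Data.List.Relation.Unary.Unique.Propositional.Properties as Unique
open import Data.List.Membership.Propositional using (_∈_)
open import Data.List.Membership.Propositional.Properties using (∈-map⁺; ∈-map⁻; ∈-upTo⁺; ∈-upTo⁻; ++-∈⇔)
open import Data.List.Reverse using (Reverse; []; _∶_∶ʳ_; reverseView)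
open import Data.Maybe using (Maybe; just; nothing)
import Data.Maybe as Maybe
open import Data.Maybe.Properties using () renaming (map-∘ to Maybe-map-∘)
open import Data.Product using (Σ-syntax; ∃-syntax; _×_; _,_; proj₁; proj₂)
open import Data.Sum using (_⊎_; inj₁; inj₂; swap)
open import Data.Unit using (⊤; tt)
open import Function using (_∘_)
open import Function.Bundles using (_⇔_; mk⇔; Equivalence)
import Function.Properties.Equivalence as ⇔
open import Relation.Nullary using (contradiction)
open import Relation.Binary.PropositionalEquality
open ≡-Reasoning

-- Positions in a string

isElem isEmpty isL isR : Maybe Cell → Bool
isElem (just L) = true
isElem (just R) = true
isElem _        = false
isEmpty (just o) = true
isEmpty _        = false
isL (just L) = true
isL _        = false
isR (just R) = true
isR _        = false

isElemAt-cellAt : ∀ s j → isElemAt s j ≡ isElem (cellAt s j)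
isElemAt-cellAt s j with cellAt s j
... | just o  = refl
... | just L  = refl
... | just R  = refl
... | nothing = refl

isEmptyAt-cellAt : ∀ s j → isEmptyAt s j ≡ isEmpty (cellAt s j)
isEmptyAt-cellAt s j with cellAt s j
... | just o  = refl
... | just L  = refl
... | just R  = refl
... | nothing = refl

isLAt-cellAt : ∀ s j → isLAt s j ≡ isL (cellAt s j)
isLAt-cellAt s j with cellAt s j
... | just o  = refl
... | just L  = refl
... | just R  = refl
... | nothing = refl

isRAt-cellAt : ∀ s j → isRAt s j ≡ isR (cellAt s j)
isRAt-cellAt s j with cellAt s j
... | just o  = refl
... | just L  = refl
... | just R  = refl
... | nothing = refl

NoEmpty : List Cell → Set
NoEmpty = All (λ c → c ≢ o)

gap : ℕ → List Cell
gap e = replicate e o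

AllEmpty : List Cell → Set
AllEmpty = All (_≡ o)

gap-allEmpty : ∀ e → AllEmpty (gap e)
gap-allEmpty e = All.replicate⁺ e refl

isEmpty-noEmpty : ∀ {S} → NoEmpty S → ∀ j → isEmpty (cellAt S j) ≡ false
isEmpty-noEmpty {[]}    []          j       = refl
isEmpty-noEmpty {o ∷ S} (c≢o ∷ _)   zero    = contradiction refl c≢o
isEmpty-noEmpty {L ∷ S} _           zero    = refl
isEmpty-noEmpty {R ∷ S} _           zero    = refl
isEmpty-noEmpty {c ∷ S} (_ ∷ noE)   (suc j) = isEmpty-noEmpty noE j

isEmpty-just : ∀ {c} → c ≢ o → isEmpty (just c) ≡ false
isEmpty-just {o} c≢o = contradiction refl c≢o
isEmpty-just {L} _   = refl
isEmpty-just {R} _   = refl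

isElem-just : ∀ {c} → c ≢ o → isElem (just c) ≡ true
isElem-just {o} c≢o = contradiction refl c≢o
isElem-just {L} _   = refl
isElem-just {R} _   = refl

isElem-empty : ∀ {G} → AllEmpty G → All (λ c → isElem (just c) ≡ false) G
isElem-empty = All.map λ { refl → refl }

flip-≢o : ∀ {c} → c ≢ o → flip c ≢ o
flip-≢o {o} c≢o = c≢o
flip-≢o {L} _   = λ ()
flip-≢o {R} _   = λ ()

cellAt-++ʳ : ∀ X S i → cellAt (X ++ S) (length X + i) ≡ cellAt S i
cellAt-++ʳ []      S i = refl
cellAt-++ʳ (x ∷ X) S i = cellAt-++ʳ X S i

cellAt-++ˡ : ∀ X S {j} → j < length X → cellAt (X ++ S) j ≡ cellAt X j
cellAt-++ˡ (x ∷ X) S {zero}  _         = refl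
cellAt-++ˡ (x ∷ X) S {suc j} (s≤s j<) = cellAt-++ˡ X S j<

cellAt-++-≥ : ∀ X S {q} → length X ≤ q → cellAt (X ++ S) q ≡ cellAt S (q ∸ length X)
cellAt-++-≥ X S {q} X≤q = begin
  cellAt (X ++ S) q                           ≡⟨ cong (cellAt (X ++ S)) (sym (m+[n∸m]≡n X≤q)) ⟩
  cellAt (X ++ S) (length X + (q ∸ length X)) ≡⟨ cellAt-++ʳ X S (q ∸ length X) ⟩
  cellAt S (q ∸ length X)                     ∎

cellAt-at : ∀ X c S → cellAt (X ++ c ∷ S) (length X) ≡ just c
cellAt-at []      c S = refl
cellAt-at (x ∷ X) c S = cellAt-at X c S

cellAt-after : ∀ X c S → cellAt (X ++ c ∷ S) (suc (length X)) ≡ cellAt S 0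
cellAt-after []      c S = refl
cellAt-after (x ∷ X) c S = cellAt-after X c S

length-replicate-++ : ∀ n (c : Cell) S → length (replicate n c ++ S) ≡ n + length S
length-replicate-++ n c S = trans (length-++ (replicate n c)) (cong (_+ length S) (length-replicate n))

replicate-++-∷ : ∀ n (c : Cell) S → replicate n c ++ c ∷ S ≡ c ∷ replicate n c ++ S
replicate-++-∷ zero    c S = refl
replicate-++-∷ (suc n) c S = cong (c ∷_) (replicate-++-∷ n c S)

replicate-∷ʳ : ∀ n (c : Cell) → replicate n c ∷ʳ c ≡ replicate (suc n) c
replicate-∷ʳ zero    c = refl
replicate-∷ʳ (suc n) c = cong (c ∷_) (replicate-∷ʳ n c)

cellAt-replicate-at : ∀ n c d S → cellAt (replicate n c ++ d ∷ S) n ≡ just d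
cellAt-replicate-at zero    c d S = refl
cellAt-replicate-at (suc n) c d S = cellAt-replicate-at n c d S

cellAt-replicate : ∀ n c S {t} → t < n → cellAt (replicate n c ++ S) t ≡ just c
cellAt-replicate (suc n) c S {zero}  _        = refl
cellAt-replicate (suc n) c S {suc t} (s≤s t<) = cellAt-replicate n c S t<

set-++ʳ : ∀ X S i d → set (X ++ S) (length X + i) d ≡ X ++ set S i d
set-++ʳ []      S i d = refl
set-++ʳ (x ∷ X) S i d = cong (x ∷_) (set-++ʳ X S i d)

set-at : ∀ X c S d → set (X ++ c ∷ S) (length X) d ≡ X ++ d ∷ S
set-at []      c S d = refl
set-at (x ∷ X) c S d = cong (x ∷_) (set-at X c S d)

set-after : ∀ X c d S e → set (X ++ c ∷ d ∷ S) (suc (length X)) e ≡ X ++ c ∷ e ∷ S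
set-after []      c d S e = refl
set-after (x ∷ X) c d S e = cong (x ∷_) (set-after X c d S e)

set-replicate : ∀ n c d S e → set (replicate n c ++ d ∷ S) n e ≡ replicate n c ++ e ∷ S
set-replicate zero    c d S e = refl
set-replicate (suc n) c d S e = cong (c ∷_) (set-replicate n c d S e)

scan : (Maybe Cell → Bool) → List Cell → ℕ → Maybe ℕ
scan p s zero    = nothing
scan p s (suc j) = if p (cellAt s j) then just j else scan p s j

prevElem-scan : ∀ s i → prevElem s i ≡ scan isElem s i
prevElem-scan s zero    = refl
prevElem-scan s (suc i) rewrite isElemAt-cellAt s i | prevElem-scan s i = refl

prevEmpty-scan : ∀ s i → prevEmpty s i ≡ scan isEmpty s i
prevEmpty-scan s zero    = refl
prevEmpty-scan s (suc i) rewrite isEmptyAt-cellAt s i | prevEmpty-scan s i = refl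

scan-++ˡ : ∀ p X S {i} → i ≤ length X → scan p (X ++ S) i ≡ scan p X i
scan-++ˡ p X S {zero}  _  = refl
scan-++ˡ p X S {suc i} i< rewrite cellAt-++ˡ X S i< | scan-++ˡ p X S (<⇒≤ i<) = refl

scan-at : ∀ p X S → scan p (X ++ S) (length X) ≡ scan p X (length X)
scan-at p X S = scan-++ˡ p X S ≤-refl

scan-< : ∀ p s {i q} → scan p s i ≡ just q → q < i
scan-< p s {suc i} eq with p (cellAt s i)
scan-< p s {suc i} refl | true  = ≤-refl
scan-< p s {suc i} eq   | false = m≤n⇒m≤1+n (scan-< p s eq)

length-∷ʳ : ∀ (X : List Cell) c → length (X ∷ʳ c) ≡ suc (length X)
length-∷ʳ X c = trans (length-++ X) (+-comm (length X) 1)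

scan-∷ʳ : ∀ p X c → scan p (X ∷ʳ c) (length (X ∷ʳ c)) ≡ (if p (just c) then just (length X) else scan p X (length X))
scan-∷ʳ p X c rewrite length-∷ʳ X c | cellAt-at X c [] | scan-at p X (c ∷ []) = refl

mutual
  scan-skip : ∀ p X {Z} → All (λ c → p (just c) ≡ false) Z → scan p (X ++ Z) (length (X ++ Z)) ≡ scan p X (length X)
  scan-skip p X {[]}    []        rewrite ++-identityʳ X = refl
  scan-skip p X {z ∷ Z} (pz ∷ pZ) =
    trans (scan-last p X Z pZ) (cong (λ b → if b then just (length X) else scan p X (length X)) pz)

  scan-last : ∀ p X {c} Z → All (λ d → p (just d) ≡ false) Z →
              scan p (X ++ c ∷ Z) (length (X ++ c ∷ Z)) ≡ (if p (just c) then just (length X) else scan p X (length X))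
  scan-last p X {c} Z pZ = begin
    scan p (X ++ c ∷ Z) (length (X ++ c ∷ Z))
      ≡⟨ cong (λ Y → scan p Y (length Y)) (sym (++-assoc X (c ∷ []) Z)) ⟩
    scan p ((X ∷ʳ c) ++ Z) (length ((X ∷ʳ c) ++ Z))
      ≡⟨ scan-skip p (X ∷ʳ c) pZ ⟩
    scan p (X ∷ʳ c) (length (X ∷ʳ c))
      ≡⟨ scan-∷ʳ p X c ⟩
    (if p (just c) then just (length X) else scan p X (length X)) ∎

scan-hit : ∀ p X {c} Z → p (just c) ≡ true → All (λ d → p (just d) ≡ false) Z →
           scan p (X ++ c ∷ Z) (length (X ++ c ∷ Z)) ≡ just (length X)
scan-hit p X Z pc pZ = trans (scan-last p X Z pZ) (cong (λ b → if b then just (length X) else scan p X (length X)) pc)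

searchEmpty-++ʳ : ∀ X S j m → searchEmpty (X ++ S) (length X + j) m ≡ Maybe.map (length X +_) (searchEmpty S j m)
searchEmpty-++ʳ X S j zero    = refl
searchEmpty-++ʳ X S j (suc m)
  rewrite isEmptyAt-cellAt (X ++ S) (length X + j) | cellAt-++ʳ X S j | isEmptyAt-cellAt S j
  with isEmpty (cellAt S j)
... | true  = refl
... | false rewrite sym (+-suc (length X) j) = searchEmpty-++ʳ X S (suc j) m

nextEmpty-at : ∀ X c S → nextEmpty (X ++ c ∷ S) (length X) ≡ Maybe.map (λ k → length X + suc k) (searchEmpty S 0 (length S))
nextEmpty-at X c S = begin
  searchEmpty (X ++ c ∷ S) (suc (length X)) (length (X ++ c ∷ S) ∸ suc (length X))
    ≡⟨ cong₂ (searchEmpty (X ++ c ∷ S)) (sym (+-comm (length X) 1)) remaining ⟩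
  searchEmpty (X ++ c ∷ S) (length X + 1) (length S)
    ≡⟨ searchEmpty-++ʳ X (c ∷ S) 1 (length S) ⟩
  Maybe.map (length X +_) (searchEmpty (c ∷ S) 1 (length S))
    ≡⟨ cong (Maybe.map (length X +_)) (searchEmpty-++ʳ (c ∷ []) S 0 (length S)) ⟩
  Maybe.map (length X +_) (Maybe.map suc (searchEmpty S 0 (length S)))
    ≡⟨ sym (Maybe-map-∘ (searchEmpty S 0 (length S))) ⟩
  Maybe.map (λ k → length X + suc k) (searchEmpty S 0 (length S)) ∎
  where
  remaining : length (X ++ c ∷ S) ∸ suc (length X) ≡ length S
  remaining = begin
    length (X ++ c ∷ S) ∸ suc (length X)   ≡⟨ cong (_∸ suc (length X)) (length-++ X) ⟩
    length X + suc (length S) ∸ suc (length X) ≡⟨ cong (_∸ suc (length X)) (+-suc (length X) (length S)) ⟩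
    length X + length S ∸ length X         ≡⟨ m+n∸m≡n (length X) (length S) ⟩
    length S                               ∎

searchEmpty-noEmpty : ∀ {S} → NoEmpty S → ∀ j m → searchEmpty S j m ≡ nothing
searchEmpty-noEmpty noE j zero = refl
searchEmpty-noEmpty {S} noE j (suc m) rewrite isEmptyAt-cellAt S j | isEmpty-noEmpty noE j = searchEmpty-noEmpty noE (suc j) m

searchEmpty-Rs : ∀ n Y m → n < m → searchEmpty (replicate n R ++ o ∷ Y) 0 m ≡ just n
searchEmpty-Rs zero    Y (suc m) _        = refl
searchEmpty-Rs (suc n) Y (suc m) (s≤s n<m) = begin
  searchEmpty (R ∷ replicate n R ++ o ∷ Y) 1 m                ≡⟨ searchEmpty-++ʳ (R ∷ []) (replicate n R ++ o ∷ Y) 0 m ⟩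
  Maybe.map suc (searchEmpty (replicate n R ++ o ∷ Y) 0 m)   ≡⟨ cong (Maybe.map suc) (searchEmpty-Rs n Y m n<m) ⟩
  just (suc n)                                                ∎

allB-true : ∀ f {xs : List ℕ} → (∀ {x} → x ∈ xs → f x ≡ true) → allB f xs ≡ true
allB-true f {[]}     _   = refl
allB-true f {x ∷ xs} all rewrite all (here refl) = allB-true f (λ x∈ → all (there x∈))

allB-false : ∀ f {xs : List ℕ} {x} → x ∈ xs → f x ≡ false → allB f xs ≡ false
allB-false f {y ∷ xs} (here refl) fx rewrite fx = refl
allB-false f {y ∷ xs} (there x∈)  fx with f y
... | true  = allB-false f x∈ fx
... | false = refl

∈-between⁻ : ∀ {p i q} → q ∈ between p i → p < q × q < i
∈-between⁻ {p} {i} q∈ with ∈-map⁻ (λ t → suc (p + t)) q∈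
... | t , t∈ , refl =
  s≤s (m≤m+n p t) , subst (suc (p + t) <_) (m+[n∸m]≡n p<i) (+-monoʳ-< (suc p) (∈-upTo⁻ t∈))
  where
  p<i : p < i
  p<i = <⇒≤ (m∸n≢0⇒n<m (λ eq → n≮0 (subst (t <_) eq (∈-upTo⁻ t∈))))

∈-between⁺ : ∀ {p i q} → p < q → q < i → q ∈ between p i
∈-between⁺ {p} {i} {q} p<q q<i =
  subst (_∈ between p i) (m+[n∸m]≡n p<q) (∈-map⁺ (λ t → suc (p + t)) (∈-upTo⁺ (∸-monoˡ-< q<i p<q)))

cells-between : ∀ (F : Maybe Cell → Bool) X S k → (∀ t → 0 < t → t < k → F (cellAt S t) ≡ true) →
                ∀ {q} → length X < q → q < length X + k → F (cellAt (X ++ S) q) ≡ true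
cells-between F X S k inside {q} X<q q<k = begin
  F (cellAt (X ++ S) q)            ≡⟨ cong F (cellAt-++-≥ X S (<⇒≤ X<q)) ⟩
  F (cellAt S (q ∸ length X))      ≡⟨ inside (q ∸ length X) (m<n⇒0<n∸m X<q) offset<k ⟩
  true                             ∎
  where
  offset<k : q ∸ length X < k
  offset<k = subst (q ∸ length X <_) (m+n∸m≡n (length X) k) (∸-monoˡ-< q<k (<⇒≤ X<q))

-- The moves of the procedure

reversal : List Cell → Cell → List Cell → Outcome
reversal X c S = reversed (X ++ c ∷ S) (prevElem (X ++ c ∷ S) (length X))

step-at-R : ∀ s i → cellAt s i ≡ just R → step s i ≡ stepR s i
step-at-R s i eq rewrite eq = refl

step-at-L : ∀ s i → cellAt s i ≡ just L → step s i ≡ stepL s i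
step-at-L s i eq rewrite eq = refl

stepR-rule2 : ∀ s i → isEmptyAt s (suc i) ≡ true → stepR s i ≡ moved (set (set s (suc i) R) i o)
stepR-rule2 s i eq rewrite eq = refl

stepR-not-rule2 : ∀ s i → isEmptyAt s (suc i) ≡ false → stepR s i ≡ stepR4 s i
stepR-not-rule2 s i eq rewrite eq = refl

stepR4-rule4 : ∀ s i p → nextEmpty s i ≡ just p → allB (isRAt s) (between i p) ≡ true →
              stepR4 s i ≡ moved (set (set s p R) i o)
stepR4-rule4 s i p eq all rewrite eq | all = refl

stepR4-no-empty : ∀ s i → nextEmpty s i ≡ nothing → stepR4 s i ≡ step5 s i R
stepR4-no-empty s i eq rewrite eq = refl

stepL-rule2 : ∀ s j → isEmptyAt s j ≡ true → stepL s (suc j) ≡ moved (set (set s j L) (suc j) o)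
stepL-rule2 s j eq rewrite eq = refl

stepL-not-rule2 : ∀ s j → isEmptyAt s j ≡ false → stepL s (suc j) ≡ stepL3 s (suc j)
stepL-not-rule2 s j eq rewrite eq = refl

stepL3-rule3 : ∀ s i p → prevEmpty s i ≡ just p → allB (isLAt s) (between p i) ≡ true →
              stepL3 s i ≡ moved (foldr (λ j t → set t j R) (set (set s p L) i o) (between p i))
stepL3-rule3 s i p eq all rewrite eq | all = refl

stepL3-no-empty : ∀ s i → prevEmpty s i ≡ nothing → stepL3 s i ≡ step5 s i L
stepL3-no-empty s i eq rewrite eq = refl

stepL3-not-all-L : ∀ s i p → prevEmpty s i ≡ just p → allB (isLAt s) (between p i) ≡ false → stepL3 s i ≡ step5 s i L
stepL3-not-all-L s i p eq all rewrite eq | all = refl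

step5-at : ∀ X c S → step5 (X ++ c ∷ S) (length X) c ≡ reversal X (flip c) S
step5-at X c S = cong (λ t → reversed t (prevElem t (length X))) (set-at X c S (flip c))

step-R-slide : ∀ X Y → step (X ++ R ∷ o ∷ Y) (length X) ≡ moved (X ++ o ∷ R ∷ Y)
step-R-slide X Y = begin
  step s (length X)
    ≡⟨ step-at-R s (length X) (cellAt-at X R (o ∷ Y)) ⟩
  stepR s (length X)
    ≡⟨ stepR-rule2 s (length X) (trans (isEmptyAt-cellAt s _) (cong isEmpty (cellAt-after X R (o ∷ Y)))) ⟩
  moved (set (set s (suc (length X)) R) (length X) o)
    ≡⟨ cong (λ t → moved (set t (length X) o)) (set-after X R o Y R) ⟩
  moved (set (X ++ R ∷ R ∷ Y) (length X) o)
    ≡⟨ cong moved (set-at X R (R ∷ Y) o) ⟩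
  moved (X ++ o ∷ R ∷ Y) ∎
  where
  s = X ++ R ∷ o ∷ Y

step-R-blocked : ∀ X Y → NoEmpty Y → step (X ++ R ∷ Y) (length X) ≡ reversal X L Y
step-R-blocked X Y noE = begin
  step s (length X)
    ≡⟨ step-at-R s (length X) (cellAt-at X R Y) ⟩
  stepR s (length X)
    ≡⟨ stepR-not-rule2 s (length X) nextNotEmpty ⟩
  stepR4 s (length X)
    ≡⟨ stepR4-no-empty s (length X) noEmptyAfter ⟩
  step5 s (length X) R
    ≡⟨ step5-at X R Y ⟩
  reversal X L Y ∎
  where
  s = X ++ R ∷ Y
  nextNotEmpty : isEmptyAt s (suc (length X)) ≡ false
  nextNotEmpty = trans (isEmptyAt-cellAt s _) (trans (cong isEmpty (cellAt-after X R Y)) (isEmpty-noEmpty noE 0))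
  noEmptyAfter : nextEmpty s (length X) ≡ nothing
  noEmptyAfter = trans (nextEmpty-at X R Y) (cong (Maybe.map _) (searchEmpty-noEmpty noE 0 (length Y)))

step-R-jump : ∀ X b Y → step (X ++ R ∷ replicate (suc b) R ++ o ∷ Y) (length X) ≡ moved (X ++ o ∷ replicate (suc b) R ++ R ∷ Y)
step-R-jump X b Y = begin
  step s (length X)
    ≡⟨ step-at-R s (length X) (cellAt-at X R S) ⟩
  stepR s (length X)
    ≡⟨ stepR-not-rule2 s (length X) (trans (isEmptyAt-cellAt s _) (cong isEmpty (cellAt-after X R S))) ⟩
  stepR4 s (length X)
    ≡⟨ stepR4-rule4 s (length X) p next allR ⟩
  moved (set (set s p R) (length X) o)
    ≡⟨ cong (λ t → moved (set t (length X) o)) (set-++ʳ X (R ∷ S) (suc (suc b)) R) ⟩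
  moved (set (X ++ R ∷ set S (suc b) R) (length X) o)
    ≡⟨ cong (λ t → moved (set (X ++ R ∷ t) (length X) o)) (set-replicate (suc b) R o Y R) ⟩
  moved (set (X ++ R ∷ replicate (suc b) R ++ R ∷ Y) (length X) o)
    ≡⟨ cong moved (set-at X R _ o) ⟩
  moved (X ++ o ∷ replicate (suc b) R ++ R ∷ Y) ∎
  where
  S = replicate (suc b) R ++ o ∷ Y
  s = X ++ R ∷ S
  p = length X + suc (suc b)
  suc-b<|S| : suc b < length S
  suc-b<|S| = subst (suc b <_) (sym (length-replicate-++ (suc b) R (o ∷ Y))) (m<m+n (suc b) (s≤s z≤n))
  next : nextEmpty s (length X) ≡ just p
  next = trans (nextEmpty-at X R S) (cong (Maybe.map _) (searchEmpty-Rs (suc b) Y (length S) suc-b<|S|))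
  allR : allB (isRAt s) (between (length X) p) ≡ true
  allR = allB-true (isRAt s) λ q∈ → let X<q , q<p = ∈-between⁻ q∈ in
    trans (isRAt-cellAt s _)
      (cells-between isR X (R ∷ S) (suc (suc b))
        (λ { (suc t) _ (s≤s t<) → cong isR (cellAt-replicate (suc b) R (o ∷ Y) t<) }) X<q q<p)

step-L-slide : ∀ X Y → step ((X ++ o ∷ []) ++ L ∷ Y) (length (X ++ o ∷ [])) ≡ moved (X ++ L ∷ o ∷ Y)
step-L-slide X Y = begin
  step ((X ++ o ∷ []) ++ L ∷ Y) (length (X ++ o ∷ []))
    ≡⟨ cong₂ step (++-assoc X (o ∷ []) (L ∷ Y)) (length-∷ʳ X o) ⟩
  step s (suc (length X))
    ≡⟨ step-at-L s _ (cellAt-after X o (L ∷ Y)) ⟩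
  stepL s (suc (length X))
    ≡⟨ stepL-rule2 s (length X) (trans (isEmptyAt-cellAt s _) (cong isEmpty (cellAt-at X o (L ∷ Y)))) ⟩
  moved (set (set s (length X) L) (suc (length X)) o)
    ≡⟨ cong (λ t → moved (set t (suc (length X)) o)) (set-at X o (L ∷ Y) L) ⟩
  moved (set (X ++ L ∷ L ∷ Y) (suc (length X)) o)
    ≡⟨ cong moved (set-after X L L Y o) ⟩
  moved (X ++ L ∷ o ∷ Y) ∎
  where
  s = X ++ o ∷ L ∷ Y

setR-over-Ls : ∀ X d n Z → foldr (λ j t → set t j R) (X ++ d ∷ replicate n L ++ Z) (map (λ t → suc (length X + t)) (upTo n))
                     ≡ X ++ d ∷ replicate n R ++ Z
setR-over-Ls X d zero    Z = refl
setR-over-Ls X d (suc n) Z = begin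
  foldr setR (X ++ d ∷ replicate (suc n) L ++ Z) (map g (upTo (suc n)))
    ≡⟨ cong (λ js → foldr setR (X ++ d ∷ replicate (suc n) L ++ Z) (map g js)) (sym (upTo-∷ʳ n)) ⟩
  foldr setR (X ++ d ∷ replicate (suc n) L ++ Z) (map g (upTo n ∷ʳ n))
    ≡⟨ cong (foldr setR (X ++ d ∷ replicate (suc n) L ++ Z)) (map-++ g (upTo n) (n ∷ [])) ⟩
  foldr setR (X ++ d ∷ replicate (suc n) L ++ Z) (map g (upTo n) ∷ʳ g n)
    ≡⟨ foldr-∷ʳ setR _ (g n) (map g (upTo n)) ⟩
  foldr setR (set (X ++ d ∷ replicate (suc n) L ++ Z) (g n) R) (map g (upTo n))
    ≡⟨ cong (λ t → foldr setR t (map g (upTo n))) setLast ⟩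
  foldr setR (X ++ d ∷ replicate n L ++ R ∷ Z) (map g (upTo n))
    ≡⟨ setR-over-Ls X d n (R ∷ Z) ⟩
  X ++ d ∷ replicate n R ++ R ∷ Z
    ≡⟨ cong (λ t → X ++ d ∷ t) (replicate-++-∷ n R Z) ⟩
  X ++ d ∷ replicate (suc n) R ++ Z ∎
  where
  setR : ℕ → List Cell → List Cell
  setR j t = set t j R
  g : ℕ → ℕ
  g t = suc (length X + t)
  setLast : set (X ++ d ∷ replicate (suc n) L ++ Z) (g n) R ≡ X ++ d ∷ replicate n L ++ R ∷ Z
  setLast = begin
    set (X ++ d ∷ replicate (suc n) L ++ Z) (suc (length X + n)) R
      ≡⟨ cong₂ (λ t j → set (X ++ d ∷ t) j R) (sym (replicate-++-∷ n L Z)) (sym (+-suc (length X) n)) ⟩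
    set (X ++ d ∷ replicate n L ++ L ∷ Z) (length X + suc n) R
      ≡⟨ set-++ʳ X (d ∷ replicate n L ++ L ∷ Z) (suc n) R ⟩
    X ++ d ∷ set (replicate n L ++ L ∷ Z) n R
      ≡⟨ cong (λ t → X ++ d ∷ t) (set-replicate n L L Z R) ⟩
    X ++ d ∷ replicate n L ++ R ∷ Z ∎

step-L-jump : ∀ X c Y → step ((X ++ o ∷ replicate (suc c) L) ++ L ∷ Y) (length (X ++ o ∷ replicate (suc c) L))
                      ≡ moved (X ++ L ∷ replicate (suc c) R ++ o ∷ Y)
step-L-jump X c Y = begin
  step s (length W)
    ≡⟨ cong₂ step (++-assoc X (o ∷ Ls) (L ∷ Y)) |W| ⟩
  step s′ (suc j)
    ≡⟨ step-at-L s′ (suc j) activeL ⟩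
  stepL s′ (suc j)
    ≡⟨ stepL-not-rule2 s′ j (trans (isEmptyAt-cellAt s′ j) (cong isEmpty previousL)) ⟩
  stepL3 s′ (suc j)
    ≡⟨ stepL3-rule3 s′ (suc j) (length X) prevEmpty≡ allL ⟩
  moved (foldr setR (set (set s′ (length X) L) (suc j) o) (between (length X) (suc j)))
    ≡⟨ cong₂ (λ t js → moved (foldr setR t js)) moveActive between≡ ⟩
  moved (foldr setR (X ++ L ∷ Ls ++ o ∷ Y) (map (λ t → suc (length X + t)) (upTo (suc c))))
    ≡⟨ cong moved (setR-over-Ls X L (suc c) (o ∷ Y)) ⟩
  moved (X ++ L ∷ replicate (suc c) R ++ o ∷ Y) ∎
  where
  Ls = replicate (suc c) L
  W  = X ++ o ∷ Ls
  s  = W ++ L ∷ Y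
  S  = o ∷ Ls ++ L ∷ Y
  s′ = X ++ S
  j  = length X + suc c
  setR : ℕ → List Cell → List Cell
  setR j t = set t j R
  |W| : length W ≡ suc j
  |W| = trans (length-++ X) (trans (cong (λ n → length X + suc n) (length-replicate (suc c))) (+-suc (length X) (suc c)))
  activeL : cellAt s′ (suc j) ≡ just L
  activeL = trans (cong (cellAt s′) (sym (+-suc (length X) (suc c))))
              (trans (cellAt-++ʳ X S (suc (suc c))) (cellAt-replicate-at (suc c) L L Y))
  previousL : cellAt s′ j ≡ just L
  previousL = trans (cellAt-++ʳ X S (suc c)) (cellAt-replicate (suc c) L (L ∷ Y) ≤-refl)
  prevEmpty≡ : prevEmpty s′ (suc j) ≡ just (length X)
  prevEmpty≡ = subst₂ (λ t i → prevEmpty t i ≡ just (length X)) (++-assoc X (o ∷ Ls) (L ∷ Y)) |W|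
    (trans (prevEmpty-scan s (length W)) (trans (scan-at isEmpty W (L ∷ Y))
      (scan-hit isEmpty X Ls refl (All.replicate⁺ (suc c) refl))))
  allL : allB (isLAt s′) (between (length X) (suc j)) ≡ true
  allL = allB-true (isLAt s′) λ {q} q∈ → let X<q , q<j = ∈-between⁻ q∈ in
    trans (isLAt-cellAt s′ _)
      (cells-between isL X S (suc (suc c))
        (λ { (suc t) _ (s≤s t<) → cong isL (cellAt-replicate (suc c) L (L ∷ Y) t<) })
        X<q (subst (q <_) (sym (+-suc (length X) (suc c))) q<j))
  moveActive : set (set s′ (length X) L) (suc j) o ≡ X ++ L ∷ Ls ++ o ∷ Y
  moveActive = begin
    set (set s′ (length X) L) (suc j) o
      ≡⟨ cong₂ (λ t i → set t i o) (set-at X o (Ls ++ L ∷ Y) L) (sym (+-suc (length X) (suc c))) ⟩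
    set (X ++ L ∷ Ls ++ L ∷ Y) (length X + suc (suc c)) o
      ≡⟨ set-++ʳ X (L ∷ Ls ++ L ∷ Y) (suc (suc c)) o ⟩
    X ++ L ∷ set (Ls ++ L ∷ Y) (suc c) o
      ≡⟨ cong (λ t → X ++ L ∷ t) (set-replicate (suc c) L L Y o) ⟩
    X ++ L ∷ Ls ++ o ∷ Y ∎
  between≡ : between (length X) (suc j) ≡ map (λ t → suc (length X + t)) (upTo (suc c))
  between≡ = cong (λ n → map (λ t → suc (length X + t)) (upTo n)) (m+n∸m≡n (length X) (suc c))

step-L-blocked : ∀ X M Y → NoEmpty M → step ((X ++ R ∷ M) ++ L ∷ Y) (length (X ++ R ∷ M)) ≡ reversal (X ++ R ∷ M) R Y
step-L-blocked X M Y noM = begin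
  step s (length W)   ≡⟨ step-at-L s (length W) (cellAt-at W L Y) ⟩
  stepL s (length W)  ≡⟨ cong (stepL s) |W| ⟩
  stepL s (suc j)     ≡⟨ stepL-not-rule2 s j (trans (isEmptyAt-cellAt s j) beforeNotEmpty) ⟩
  stepL3 s (suc j)    ≡⟨ cong (stepL3 s) (sym |W|) ⟩
  stepL3 s (length W) ≡⟨ noJump ⟩
  step5 s (length W) L ≡⟨ step5-at W L Y ⟩
  reversal W R Y      ∎
  where
  W = X ++ R ∷ M
  s = W ++ L ∷ Y
  j = length X + length M
  |W| : length W ≡ suc j
  |W| = trans (length-++ X) (+-suc (length X) (length M))
  j<W : j < length W
  j<W = subst (j <_) (sym |W|) ≤-refl
  X<W : length X < length W
  X<W = subst (length X <_) (sym |W|) (s≤s (m≤m+n (length X) (length M)))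
  noRM : NoEmpty (R ∷ M)
  noRM = (λ ()) ∷ noM
  beforeNotEmpty : isEmpty (cellAt s j) ≡ false
  beforeNotEmpty = begin
    isEmpty (cellAt s j)            ≡⟨ cong isEmpty (cellAt-++ˡ W (L ∷ Y) j<W) ⟩
    isEmpty (cellAt W j)            ≡⟨ cong isEmpty (cellAt-++ʳ X (R ∷ M) (length M)) ⟩
    isEmpty (cellAt (R ∷ M) (length M)) ≡⟨ isEmpty-noEmpty noRM (length M) ⟩
    false                           ∎
  prevEmpty≡ : prevEmpty s (length W) ≡ scan isEmpty X (length X)
  prevEmpty≡ = trans (prevEmpty-scan s (length W)) (trans (scan-at isEmpty W (L ∷ Y))
                 (scan-skip isEmpty X (All.map isEmpty-just noRM)))
  noJump : stepL3 s (length W) ≡ step5 s (length W) L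
  noJump with scan isEmpty X (length X) in eq
  ... | nothing = stepL3-no-empty s (length W) (trans prevEmpty≡ eq)
  ... | just p  = stepL3-not-all-L s (length W) p (trans prevEmpty≡ eq)
    (allB-false (isLAt s) (∈-between⁺ (scan-< isEmpty X eq) X<W)
      (trans (isLAt-cellAt s (length X)) (cong isL (trans (cellAt-++ˡ W (L ∷ Y) X<W) (cellAt-at X R M)))))

step-L-leading : ∀ b Y → step (replicate b L ++ L ∷ Y) (length (replicate b L)) ≡ reversal (replicate b L) R Y
step-L-leading zero     Y = refl
step-L-leading (suc b′) Y = begin
  step s (length W)     ≡⟨ step-at-L s (length W) (cellAt-at W L Y) ⟩
  stepL s (suc j)       ≡⟨ stepL-not-rule2 s j (trans (isEmptyAt-cellAt s j) (cong isEmpty lastL)) ⟩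
  stepL3 s (length W)   ≡⟨ stepL3-no-empty s (length W) noEmptyBefore ⟩
  step5 s (length W) L  ≡⟨ step5-at W L Y ⟩
  reversal W R Y        ∎
  where
  W = replicate (suc b′) L
  s = W ++ L ∷ Y
  j = length (replicate b′ L)
  lastL : cellAt s j ≡ just L
  lastL = cellAt-replicate (suc b′) L (L ∷ Y) (s≤s (≤-reflexive (length-replicate b′)))
  noEmptyBefore : prevEmpty s (length W) ≡ nothing
  noEmptyBefore = trans (prevEmpty-scan s (length W)) (trans (scan-at isEmpty W (L ∷ Y))
                    (scan-skip isEmpty [] (All.replicate⁺ (suc b′) refl)))

-- Runs

-- Active X S outs: on the string X ++ S with the active element at the head of S (at index length X),
-- the procedure goes on to output outs and terminate.
mutual
  data Outputs : List Cell → List (List Cell) → Set where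
    emit : ∀ {X S outs} → prevElem (X ++ S) (length (X ++ S)) ≡ just (length X) → Active X S outs →
           Outputs (X ++ S) ((X ++ S) ∷ outs)

  data Active : List Cell → List Cell → List (List Cell) → Set where
    move : ∀ {X S s outs} → step (X ++ S) (length X) ≡ moved s → Outputs s outs → Active X S outs
    halt : ∀ {X S s} → step (X ++ S) (length X) ≡ reversed s nothing → Active X S []
    pass : ∀ {X S Y T outs} → step (X ++ S) (length X) ≡ reversed (Y ++ T) (just (length Y)) →
           Active Y T outs → Active X S outs

mutual
  outputs-sound : ∀ {s outs} → Outputs s outs → ∃[ f ] (∀ g → output (f + g) s ≡ just outs)
  outputs-sound (emit {X} {S} {outs} prev act) with active-sound act
  ... | f , run = f , λ g → by g
    where
    by : ∀ g → output (f + g) (X ++ S) ≡ just ((X ++ S) ∷ outs)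
    by g rewrite prev | run g = refl

  active-sound : ∀ {X S outs} → Active X S outs → ∃[ f ] (∀ g → active (f + g) (X ++ S) (length X) ≡ just outs)
  active-sound (move {X} {S} {s} {outs} eq out) with outputs-sound out
  ... | f , run = suc f , λ g → by g
    where
    by : ∀ g → active (suc f + g) (X ++ S) (length X) ≡ just outs
    by g rewrite eq | run g = refl
  active-sound (halt {X} {S} eq) = 1 , λ g → by g
    where
    by : ∀ g → active (1 + g) (X ++ S) (length X) ≡ just []
    by g rewrite eq = refl
  active-sound (pass {X} {S} {Y} {T} {outs} eq act) with active-sound act
  ... | f , run = suc f , λ g → by g
    where
    by : ∀ g → active (suc f + g) (X ++ S) (length X) ≡ just outs
    by g rewrite eq | run g = refl

outputs⇒RunsTo : ∀ {s outs} → Outputs s outs → RunsTo s outs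
outputs⇒RunsTo out with outputs-sound out
... | f , run = f + 0 , run 0

prevElem-last : ∀ X {d} G → d ≢ o → AllEmpty G → prevElem (X ++ d ∷ G) (length (X ++ d ∷ G)) ≡ just (length X)
prevElem-last X {d} G d≢o emptyG =
  trans (prevElem-scan (X ++ d ∷ G) (length (X ++ d ∷ G))) (scan-hit isElem X G (isElem-just d≢o) (isElem-empty emptyG))

emit-last : ∀ {X d G outs} → d ≢ o → AllEmpty G → Active X (d ∷ G) outs → Outputs (X ++ d ∷ G) ((X ++ d ∷ G) ∷ outs)
emit-last {X} {d} {G} d≢o emptyG = emit (prevElem-last X G d≢o emptyG)

pass-back : ∀ {W Y d G c T S outs} → W ≡ Y ++ d ∷ G → d ≢ o → AllEmpty G →
            step (W ++ S) (length W) ≡ reversal W c T → Active Y (d ∷ G ++ c ∷ T) outs → Active W S outs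
pass-back {Y = Y} {d} {G} {c} {T} refl d≢o emptyG eq =
  pass (trans eq (cong₂ reversed (++-assoc Y (d ∷ G) (c ∷ T)) prev))
  where
  W = Y ++ d ∷ G
  prev : prevElem (W ++ c ∷ T) (length W) ≡ just (length Y)
  prev = trans (prevElem-scan (W ++ c ∷ T) (length W)) (trans (scan-at isElem W (c ∷ T))
           (trans (sym (prevElem-scan W (length W))) (prevElem-last Y G d≢o emptyG)))

step-blocked : ∀ X M S c → NoEmpty M → NoEmpty S → c ≢ o →
               step ((X ++ R ∷ M) ++ c ∷ S) (length (X ++ R ∷ M)) ≡ reversal (X ++ R ∷ M) (flip c) S
step-blocked X M S o _   _   c≢o = contradiction refl c≢o
step-blocked X M S L noM _   _   = step-L-blocked X M S noM
step-blocked X M S R _   noS _   = step-R-blocked (X ++ R ∷ M) S noS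

neg-∷ʳ-++ : ∀ xs x T → neg (xs ∷ʳ x) ++ T ≡ neg xs ++ flip x ∷ T
neg-∷ʳ-++ xs x T = trans (cong (_++ T) (map-++ flip xs (x ∷ []))) (++-assoc (neg xs) (flip x ∷ []) T)

cascade : ∀ {X M S outs} → Reverse M → NoEmpty M → NoEmpty S → ∀ {c} → c ≢ o →
          Active X (R ∷ neg M ++ flip c ∷ S) outs → Active (X ++ R ∷ M) (c ∷ S) outs
cascade {X} {S = S} [] _ noS {c} c≢o =
  pass-back refl (λ ()) [] (step-blocked X [] S c [] noS c≢o)
cascade {X} {S = S} (xs ∶ rxs ∶ʳ x) noM noS {c} c≢o act =
  pass-back (sym (++-assoc X (R ∷ xs) (x ∷ []))) x≢o [] (step-blocked X (xs ∷ʳ x) S c noM noS c≢o)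
    (cascade rxs (All.++⁻ˡ xs noM) (flip-≢o c≢o ∷ noS) x≢o
      (subst (λ T → Active X (R ∷ T) _) (neg-∷ʳ-++ xs x (flip c ∷ S)) act))
  where
  x≢o : x ≢ o
  x≢o = All.head (All.++⁻ʳ xs noM)

emit-full : ∀ {P Z outs} → Reverse Z → NoEmpty Z → Active P (R ∷ neg Z) outs → Outputs (P ++ R ∷ Z) ((P ++ R ∷ Z) ∷ outs)
emit-full [] _ = emit-last (λ ()) []
emit-full {P} {outs = outs} (xs ∶ rxs ∶ʳ x) noZ act =
  subst (λ t → Outputs t (t ∷ outs)) (++-assoc P (R ∷ xs) (x ∷ []))
    (emit-last x≢o [] (cascade rxs (All.++⁻ˡ xs noZ) [] x≢o
      (subst (λ T → Active P (R ∷ T) outs) (trans (sym (++-identityʳ _)) (neg-∷ʳ-++ xs x [])) act)))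
  where
  x≢o : x ≢ o
  x≢o = All.head (All.++⁻ʳ xs noZ)

flip-Ls : ∀ {X} b Z {outs} → Active X (R ∷ replicate (suc b) R ++ Z) outs → Active (X ++ R ∷ replicate b L) (L ∷ Z) outs
flip-Ls {X} zero    Z = pass-back refl (λ ()) [] (step-L-blocked X [] Z [])
flip-Ls {X} (suc b) Z {outs} act =
  pass-back eq (λ ()) [] (step-L-blocked X (replicate (suc b) L) Z (All.replicate⁺ (suc b) (λ ())))
    (flip-Ls b (R ∷ Z) (subst (λ T → Active X (R ∷ T) outs) (sym (replicate-++-∷ (suc b) R Z)) act))
  where
  eq : X ++ R ∷ replicate (suc b) L ≡ (X ++ R ∷ replicate b L) ++ L ∷ []
  eq = trans (cong (λ T → X ++ R ∷ T) (sym (replicate-∷ʳ b L))) (sym (++-assoc X (R ∷ replicate b L) (L ∷ [])))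

leading-Ls-halt : ∀ b Y → Active (replicate b L) (L ∷ Y) []
leading-Ls-halt zero    Y = halt (step-L-leading zero Y)
leading-Ls-halt (suc b) Y =
  pass-back (sym (replicate-∷ʳ b L)) (λ ()) [] (step-L-leading (suc b) Y) (leading-Ls-halt b (R ∷ Y))

gap-halt : ∀ e {T} → NoEmpty T → Active (gap e) (R ∷ T) []
gap-halt e {T} noT = halt (trans (step-R-blocked (gap e) T noT) (cong (reversed _) noElemBefore))
  where
  noElemBefore : prevElem (gap e ++ L ∷ T) (length (gap e)) ≡ nothing
  noElemBefore = begin
    prevElem (gap e ++ L ∷ T) (length (gap e))   ≡⟨ prevElem-scan (gap e ++ L ∷ T) (length (gap e)) ⟩
    scan isElem (gap e ++ L ∷ T) (length (gap e)) ≡⟨ scan-at isElem (gap e) (L ∷ T) ⟩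
    scan isElem (gap e) (length (gap e))         ≡⟨ scan-skip isElem [] (isElem-empty (gap-allEmpty e)) ⟩
    nothing                                      ∎

-- Placements

Enumerates : ℕ → ℕ → List (List Bool) → Set
Enumerates n k bs = Unique bs × (∀ b → (b ∈ bs) ⇔ IsPlacement n k b)

full-shape : ∀ {T} → NoEmpty T → IsPlacement (length T) (length T) (shape T)
full-shape {[]}    []         = refl , refl
full-shape {o ∷ T} (c≢o ∷ _)  = contradiction refl c≢o
full-shape {L ∷ T} (_ ∷ noT)  = let l , k = full-shape noT in cong suc l , cong suc k
full-shape {R ∷ T} (_ ∷ noT)  = let l , k = full-shape noT in cong suc l , cong suc k

vacant-shape : ∀ {G} → AllEmpty G → IsPlacement (length G) 0 (shape G)
vacant-shape {[]}    []            = refl , refl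
vacant-shape {o ∷ G} (refl ∷ emptyG) = let l , k = vacant-shape emptyG in cong suc l , k

enumerates-singleton : ∀ {n k b} → IsPlacement n k b → (∀ {b′} → IsPlacement n k b′ → b′ ≡ b) → Enumerates n k (b ∷ [])
enumerates-singleton isP onlyP = ([] ∷ []) , λ b′ → mk⇔ (λ { (here refl) → isP }) (λ isP′ → here (onlyP isP′))

ones≤length : ∀ b → ones b ≤ length b
ones≤length []          = z≤n
ones≤length (true ∷ b)  = s≤s (ones≤length b)
ones≤length (false ∷ b) = m≤n⇒m≤1+n (ones≤length b)

full-placement : ∀ {n b} → IsPlacement n n b → b ≡ replicate n true
full-placement {zero}  {[]}         _       = refl
full-placement {suc n} {true ∷ b}   (l , k) = cong (true ∷_) (full-placement (suc-injective l , suc-injective k))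
full-placement {suc n} {false ∷ b}  (l , k) =
  contradiction (subst₂ _≤_ k (suc-injective l) (ones≤length b)) (1+n≰n {n})

vacant-placement : ∀ {n b} → IsPlacement n 0 b → b ≡ replicate n false
vacant-placement {zero}  {[]}        _       = refl
vacant-placement {suc n} {false ∷ b} (l , k) = cong (false ∷_) (vacant-placement (suc-injective l , k))

enumerates-full : ∀ {n b} → IsPlacement n n b → Enumerates n n (b ∷ [])
enumerates-full isP = enumerates-singleton isP λ isP′ → trans (full-placement isP′) (sym (full-placement isP))

enumerates-vacant : ∀ {n b} → IsPlacement n 0 b → Enumerates n 0 (b ∷ [])
enumerates-vacant isP = enumerates-singleton isP λ isP′ → trans (vacant-placement isP′) (sym (vacant-placement isP))

module _ {m k X Y} (enumX : Enumerates m k X) (enumY : Enumerates m (suc k) Y) where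

  private
    occupied vacant : List (List Bool)
    occupied = map (true ∷_) X
    vacant   = map (false ∷_) Y

    to : ∀ {b} → b ∈ occupied ⊎ b ∈ vacant → IsPlacement (suc m) (suc k) b
    to (inj₁ b∈) with ∈-map⁻ (true ∷_) b∈
    ... | b′ , b′∈ , refl with Equivalence.to (proj₂ enumX b′) b′∈
    ...   | l , n = cong suc l , cong suc n
    to (inj₂ b∈) with ∈-map⁻ (false ∷_) b∈
    ... | b′ , b′∈ , refl with Equivalence.to (proj₂ enumY b′) b′∈
    ...   | l , n = cong suc l , n

    from : ∀ b → IsPlacement (suc m) (suc k) b → b ∈ occupied ⊎ b ∈ vacant
    from (true ∷ b′)  (l , n) = inj₁ (∈-map⁺ (true ∷_) (Equivalence.from (proj₂ enumX b′) (suc-injective l , suc-injective n)))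
    from (false ∷ b′) (l , n) = inj₂ (∈-map⁺ (false ∷_) (Equivalence.from (proj₂ enumY b′) (suc-injective l , n)))

    by-first-place : ∀ b → (b ∈ occupied ⊎ b ∈ vacant) ⇔ IsPlacement (suc m) (suc k) b
    by-first-place b = mk⇔ to (from b)

    unique-occupied : Unique occupied
    unique-occupied = Unique.map⁺ ∷-injectiveʳ (proj₁ enumX)

    unique-vacant : Unique vacant
    unique-vacant = Unique.map⁺ ∷-injectiveʳ (proj₁ enumY)

    apart : ∀ {b} → b ∈ occupied → b ∈ vacant → ⊥
    apart p q with ∈-map⁻ (true ∷_) p | ∈-map⁻ (false ∷_) q
    ... | _ , _ , refl | _ , _ , ()

  occupied-first : Enumerates (suc m) (suc k) (occupied ++ vacant)
  occupied-first = Unique.++⁺ unique-occupied unique-vacant (λ (p , q) → apart p q) ,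
                   λ b → ⇔.trans ++-∈⇔ (by-first-place b)

  vacant-first : Enumerates (suc m) (suc k) (vacant ++ occupied)
  vacant-first = Unique.++⁺ unique-vacant unique-occupied (λ (q , p) → apart p q) ,
                 λ b → ⇔.trans ++-∈⇔ (⇔.trans (mk⇔ swap swap) (by-first-place b))

-- Sweeps of a block

-- Behind any prefix P, the block T outputs outs and then leaves the active element at the head of Eʳ
-- in P ++ Eˡ ++ Eʳ.
BlockRun : List Cell → List (List Cell) → List Cell → List Cell → Set
BlockRun T outs Eˡ Eʳ = ∀ P rest → Active (P ++ Eˡ) Eʳ rest → Outputs (P ++ T) (map (P ++_) outs ++ rest)

run-∷ : ∀ c {T outs Eˡ Eʳ} → BlockRun T outs Eˡ Eʳ → BlockRun (c ∷ T) (map (c ∷_) outs) (c ∷ Eˡ) Eʳ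
run-∷ c {T} {outs} {Eˡ} {Eʳ} run P rest act =
  subst₂ Outputs (++-assoc P (c ∷ []) T) (cong (_++ rest) prefixes)
    (run (P ∷ʳ c) rest (subst (λ X → Active X Eʳ rest) (sym (++-assoc P (c ∷ []) Eˡ)) act))
  where
  prefixes : map ((P ∷ʳ c) ++_) outs ≡ map (P ++_) (map (c ∷_) outs)
  prefixes = trans (map-cong (++-assoc P (c ∷ [])) outs) (map-∘ outs)

run-then : ∀ {T₁ outs₁ E₁ˡ E₁ʳ T₂ outs₂ E₂ˡ E₂ʳ} → BlockRun T₁ outs₁ E₁ˡ E₁ʳ → BlockRun T₂ outs₂ E₂ˡ E₂ʳ →
           (∀ P r → Outputs (P ++ T₂) r → Active (P ++ E₁ˡ) E₁ʳ r) → BlockRun T₁ (outs₁ ++ outs₂) E₂ˡ E₂ʳ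
run-then {T₁} {outs₁} {outs₂ = outs₂} run₁ run₂ glue P rest act =
  subst (Outputs (P ++ T₁)) concatenated (run₁ P _ (glue P _ (run₂ P rest act)))
  where
  concatenated : map (P ++_) outs₁ ++ (map (P ++_) outs₂ ++ rest) ≡ map (P ++_) (outs₁ ++ outs₂) ++ rest
  concatenated = trans (sym (++-assoc (map (P ++_) outs₁) _ rest)) (cong (_++ rest) (sym (map-++ (P ++_) outs₁ outs₂)))

record Sweep (T : List Cell) (n k : ℕ) (end Eˡ Eʳ : List Cell) : Set where
  field
    outs       : List (List Cell)
    ends       : last outs ≡ just end
    enumerates : Enumerates n k (map shape outs)
    run        : BlockRun T outs Eˡ Eʳ
open Sweep

resize : ∀ {T n k n′ k′ end Eˡ Eʳ} → n ≡ n′ → k ≡ k′ → Sweep T n k end Eˡ Eʳ → Sweep T n′ k′ end Eˡ Eʳ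
resize refl refl S = S

last-++ : ∀ (xs ys : List (List Cell)) {z} → last ys ≡ just z → last (xs ++ ys) ≡ just z
last-++ []            ys       eq = eq
last-++ (x ∷ [])      (y ∷ ys) eq = eq
last-++ (x ∷ x′ ∷ xs) (y ∷ ys) eq = last-++ (x′ ∷ xs) (y ∷ ys) eq

last-map-∷ : ∀ c (xs : List (List Cell)) {z} → last xs ≡ just z → last (map (c ∷_) xs) ≡ just (c ∷ z)
last-map-∷ c xs eq = trans (last-map (c ∷_) xs) (cong (Maybe.map (c ∷_)) eq)

occupancy : Cell → Bool
occupancy o = false
occupancy _ = true

shape-∷ : ∀ c (xs : List (List Cell)) → map shape (map (c ∷_) xs) ≡ map (occupancy c ∷_) (map shape xs)
shape-∷ c []       = refl
shape-∷ o (x ∷ xs) = cong (_ ∷_) (shape-∷ o xs)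
shape-∷ L (x ∷ xs) = cong (_ ∷_) (shape-∷ L xs)
shape-∷ R (x ∷ xs) = cong (_ ∷_) (shape-∷ R xs)

shape-∷-++ : ∀ c₁ c₂ (xs ys : List (List Cell)) →
             map shape (map (c₁ ∷_) xs ++ map (c₂ ∷_) ys)
               ≡ map (occupancy c₁ ∷_) (map shape xs) ++ map (occupancy c₂ ∷_) (map shape ys)
shape-∷-++ c₁ c₂ xs ys =
  trans (map-++ shape (map (c₁ ∷_) xs) (map (c₂ ∷_) ys)) (cong₂ _++_ (shape-∷ c₁ xs) (shape-∷ c₂ ys))

module _ {T₁ n₁ k₁ end₁ E₁ˡ E₁ʳ T₂ n₂ k₂ end₂ E₂ˡ E₂ʳ}
         (S₁ : Sweep T₁ n₁ k₁ end₁ E₁ˡ E₁ʳ) (S₂ : Sweep T₂ n₂ k₂ end₂ E₂ˡ E₂ʳ) where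

  private
    sweep-then : ∀ {n k} c₁ c₂ → Enumerates n k (map shape (map (c₁ ∷_) (outs S₁) ++ map (c₂ ∷_) (outs S₂))) →
                 (∀ P r → Outputs (P ++ c₂ ∷ T₂) r → Active (P ++ c₁ ∷ E₁ˡ) E₁ʳ r) →
                 Sweep (c₁ ∷ T₁) n k (c₂ ∷ end₂) (c₂ ∷ E₂ˡ) E₂ʳ
    sweep-then c₁ c₂ enum glue = record
      { outs       = map (c₁ ∷_) (outs S₁) ++ map (c₂ ∷_) (outs S₂)
      ; ends       = last-++ (map (c₁ ∷_) (outs S₁)) _ (last-map-∷ c₂ (outs S₂) (ends S₂))
      ; enumerates = enum
      ; run        = run-then (run-∷ c₁ (run S₁)) (run-∷ c₂ (run S₂)) glue
      }

  R-then-o : n₂ ≡ n₁ → k₂ ≡ suc k₁ → (∀ P r → Outputs (P ++ o ∷ T₂) r → Active (P ++ R ∷ E₁ˡ) E₁ʳ r) →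
             Sweep (R ∷ T₁) (suc n₁) (suc k₁) (o ∷ end₂) (o ∷ E₂ˡ) E₂ʳ
  R-then-o refl refl = sweep-then R o
    (subst (Enumerates _ _) (sym (shape-∷-++ R o (outs S₁) (outs S₂)))
      (occupied-first (enumerates S₁) (enumerates S₂)))

  o-then-L : n₂ ≡ n₁ → k₁ ≡ suc k₂ → (∀ P r → Outputs (P ++ L ∷ T₂) r → Active (P ++ o ∷ E₁ˡ) E₁ʳ r) →
             Sweep (o ∷ T₁) (suc n₁) k₁ (L ∷ end₂) (L ∷ E₂ˡ) E₂ʳ
  o-then-L refl refl = sweep-then o L
    (subst (Enumerates _ _) (sym (shape-∷-++ o L (outs S₁) (outs S₂)))
      (vacant-first (enumerates S₂) (enumerates S₁)))

reroute : ∀ {T n k end E₁ˡ E₁ʳ E₂ˡ E₂ʳ} → Sweep T n k end E₁ˡ E₁ʳ →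
           (∀ P r → Active (P ++ E₂ˡ) E₂ʳ r → Active (P ++ E₁ˡ) E₁ʳ r) → Sweep T n k end E₂ˡ E₂ʳ
reroute S exit = record
  { outs = outs S ; ends = ends S ; enumerates = enumerates S
  ; run = λ P rest act → run S P rest (exit P rest act) }

emit-run : ∀ {d G} → d ≢ o → AllEmpty G → BlockRun (d ∷ G) ((d ∷ G) ∷ []) [] (d ∷ G)
emit-run {d} {G} d≢o emptyG P rest act = emit-last d≢o emptyG (subst (λ X → Active X (d ∷ G) rest) (++-identityʳ P) act)

optTail : Cell → Maybe (List Cell) → List Cell
optTail c nothing  = []
optTail c (just u) = c ∷ u

optLength : Maybe (List Cell) → ℕ
optLength nothing  = 0
optLength (just u) = suc (length u)

negOpt : Maybe (List Cell) → Maybe (List Cell)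
negOpt = Maybe.map neg

OptNoEmpty : Maybe (List Cell) → Set
OptNoEmpty nothing  = ⊤
OptNoEmpty (just u) = NoEmpty u

blockR : ℕ → ℕ → Maybe (List Cell) → List Cell
blockR a e mu = replicate (suc a) R ++ gap e ++ optTail L mu

blockL : ℕ → List Cell → List Cell
blockL e u = gap e ++ L ∷ u

SweepR : ℕ → ℕ → Maybe (List Cell) → List Cell → Set
SweepR a e mu w = Sweep (blockR a e mu) (e + suc (a + optLength mu)) (suc (a + optLength mu))
                        (gap e ++ R ∷ w) (gap e) (R ∷ neg w)

SweepL : ℕ → List Cell → ℕ → Maybe (List Cell) → Set
SweepL e u b mu = Sweep (blockL e u) (e + suc (length u)) (suc (length u))
                        (replicate (suc b) L ++ gap e ++ optTail R mu) (replicate b L) (L ∷ gap e ++ optTail L (negOpt mu))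

neg-involutive : ∀ u → neg (neg u) ≡ u
neg-involutive []      = refl
neg-involutive (o ∷ u) = cong (o ∷_) (neg-involutive u)
neg-involutive (L ∷ u) = cong (L ∷_) (neg-involutive u)
neg-involutive (R ∷ u) = cong (R ∷_) (neg-involutive u)

length-neg : ∀ u → length (neg u) ≡ length u
length-neg = length-map flip

noEmpty-neg : ∀ {u} → NoEmpty u → NoEmpty (neg u)
noEmpty-neg = All.map⁺ ∘ All.map flip-≢o

optTail-noEmpty : ∀ {c} → c ≢ o → ∀ mu → OptNoEmpty mu → NoEmpty (optTail c mu)
optTail-noEmpty c≢o nothing  _   = []
optTail-noEmpty c≢o (just u) noU = c≢o ∷ noU

length-optTail : ∀ c mu → length (optTail c mu) ≡ optLength mu
length-optTail c nothing  = refl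
length-optTail c (just u) = refl

noEmpty-replicate-optTail : ∀ a {c d} → c ≢ o → d ≢ o → ∀ mu → OptNoEmpty mu → NoEmpty (replicate a c ++ optTail d mu)
noEmpty-replicate-optTail a c≢o d≢o mu noMu = All.++⁺ (All.replicate⁺ a c≢o) (optTail-noEmpty d≢o mu noMu)

length-replicate-optTail : ∀ a c d mu → length (replicate a c ++ optTail d mu) ≡ a + optLength mu
length-replicate-optTail a c d mu = trans (length-replicate-++ a c (optTail d mu)) (cong (a +_) (length-optTail d mu))

sweepR-full : ∀ a mu → OptNoEmpty mu → SweepR a 0 mu (replicate a R ++ optTail L mu)
sweepR-full a mu noMu = record
  { outs       = blockR a 0 mu ∷ []
  ; ends       = refl
  ; enumerates = subst (λ n → Enumerates n n (shape (R ∷ Z) ∷ [])) (cong suc (length-replicate-optTail a R L mu))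
                   (enumerates-full (full-shape {R ∷ Z} ((λ ()) ∷ noZ)))
  ; run        = λ P rest act → emit-full (reverseView Z) noZ (subst (λ X → Active X (R ∷ neg Z) rest) (++-identityʳ P) act)
  }
  where
  Z = replicate a R ++ optTail L mu
  noZ : NoEmpty Z
  noZ = noEmpty-replicate-optTail a (λ ()) (λ ()) mu noMu

sweepL-full : ∀ b mu → OptNoEmpty mu → SweepL 0 (replicate b L ++ optTail R mu) b mu
sweepL-full b mu noMu = record
  { outs       = blockL 0 u ∷ []
  ; ends       = refl
  ; enumerates = enumerates-full (full-shape {L ∷ u} ((λ ()) ∷ noEmpty-replicate-optTail b (λ ()) (λ ()) mu noMu))
  ; run        = runFull mu noMu
  }
  where
  u = replicate b L ++ optTail R mu
  runFull : ∀ mu → OptNoEmpty mu → BlockRun (L ∷ replicate b L ++ optTail R mu) ((L ∷ replicate b L ++ optTail R mu) ∷ [])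
                                        (replicate b L) (L ∷ optTail L (negOpt mu))
  runFull nothing  _   P rest act =
    subst (λ t → Outputs t (t ∷ rest))
      (trans (++-assoc P (replicate b L) (L ∷ [])) (cong (P ++_) (replicate-++-∷ b L [])))
      (emit-last (λ ()) [] act)
  runFull (just w) noW P rest act =
    subst (λ t → Outputs t (t ∷ rest)) (++-assoc P (L ∷ replicate b L) (R ∷ w))
      (emit-full (reverseView w) noW
        (pass-back lastL (λ ()) [] (step-R-blocked (P ++ L ∷ replicate b L) (neg w) (noEmpty-neg noW)) act))
    where
    lastL : P ++ L ∷ replicate b L ≡ (P ++ replicate b L) ++ L ∷ []
    lastL = trans (cong (P ++_) (sym (replicate-∷ʳ b L))) (sym (++-assoc P (replicate b L) (L ∷ [])))

gap-placement : ∀ e → IsPlacement (e + 1) 0 (shape (gap (suc e) ++ []))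
gap-placement e =
  subst (λ n → IsPlacement n 0 (shape (gap (suc e) ++ []))) length-gap (vacant-shape (All.++⁺ (gap-allEmpty (suc e)) []))
  where
  length-gap : length (gap (suc e) ++ []) ≡ e + 1
  length-gap = trans (length-replicate-++ (suc e) o []) (trans (cong suc (+-identityʳ e)) (sym (+-comm e 1)))

sweepR-lone : ∀ e {w} → SweepR 0 e nothing w → SweepR 0 (suc e) nothing w
sweepR-lone e S = record
  { outs       = blockR 0 (suc e) nothing ∷ map (o ∷_) (outs S)
  ; ends       = last-++ (blockR 0 (suc e) nothing ∷ []) (map (o ∷_) (outs S)) (last-map-∷ o (outs S) (ends S))
  ; enumerates = subst (Enumerates _ _) (sym (shape-∷-++ R o (G ∷ []) (outs S)))
                   (occupied-first (enumerates-vacant (gap-placement e)) (enumerates S))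
  ; run        = run-then (emit-run (λ ()) (All.++⁺ (gap-allEmpty (suc e)) [])) (run-∷ o (run S))
                   λ P r out → subst (λ X → Active X (R ∷ G) r) (sym (++-identityʳ P))
                                 (move (step-R-slide P (gap e ++ [])) out)
  }
  where
  G = gap (suc e) ++ []

sweepL-lone : ∀ e → SweepL e [] 0 nothing → SweepL (suc e) [] 0 nothing
sweepL-lone e S = record
  { outs       = map (o ∷_) (outs S) ++ (L ∷ G) ∷ []
  ; ends       = last-++ (map (o ∷_) (outs S)) _ refl
  ; enumerates = subst (Enumerates _ _) (sym (shape-∷-++ o L (outs S) (G ∷ [])))
                   (vacant-first (enumerates-vacant (gap-placement e)) (enumerates S))
  ; run        = run-then (run-∷ o (run S)) (emit-run (λ ()) (All.++⁺ (gap-allEmpty (suc e)) []))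
                   λ P r out → move (step-L-slide P (gap e ++ [])) out
  }
  where
  G = gap (suc e) ++ []

optLength-neg : ∀ mu → optLength (negOpt mu) ≡ optLength mu
optLength-neg nothing  = refl
optLength-neg (just u) = cong suc (length-neg u)

sweepR-slide : ∀ a e mu {w₁ w₂} → NoEmpty w₁ → length w₁ ≡ a + optLength mu →
               SweepR a (suc e) mu w₁ → SweepR 0 e (just (neg w₁)) w₂ → SweepR (suc a) (suc e) mu w₂
sweepR-slide a e mu {w₁} noW₁ |w₁| S₁ S₂ =
  resize (cong suc (sym (+-suc e (suc m)))) refl (R-then-o S₁ S₂ sameLength (cong (λ n → suc (suc n)) |neg-w₁|) glue)
  where
  m = a + optLength mu
  |neg-w₁| : length (neg w₁) ≡ m
  |neg-w₁| = trans (length-neg w₁) |w₁|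
  sameLength : e + suc (suc (length (neg w₁))) ≡ suc (e + suc m)
  sameLength = trans (+-suc e (suc (length (neg w₁)))) (cong (λ n → suc (e + suc n)) |neg-w₁|)
  glue : ∀ P r → Outputs (P ++ o ∷ blockR 0 e (just (neg w₁))) r → Active (P ++ R ∷ gap (suc e)) (R ∷ neg w₁) r
  glue P r out = pass-back refl (λ ()) (gap-allEmpty (suc e))
    (step-R-blocked (P ++ R ∷ gap (suc e)) (neg w₁) (noEmpty-neg noW₁))
    (move (step-R-slide P (gap e ++ L ∷ neg w₁)) out)

sweepR-jump : ∀ e u b mu {w} → b + optLength mu ≡ length u →
              SweepL (suc e) u b mu → SweepR (suc b) e (negOpt mu) w → SweepR 0 (suc e) (just u) w
sweepR-jump e u b mu {w} b+|mu| S₁ S₂ =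
  resize (cong suc (sym (+-suc e (suc (length u))))) refl (R-then-o S₁ S₂ sameLength (cong (λ n → suc (suc n)) K) glue)
  where
  tail = optTail L (negOpt mu)
  K : b + optLength (negOpt mu) ≡ length u
  K = trans (cong (b +_) (optLength-neg mu)) b+|mu|
  sameLength : e + suc (suc (b + optLength (negOpt mu))) ≡ suc (e + suc (length u))
  sameLength = trans (+-suc e _) (cong (λ n → suc (e + suc n)) K)
  glue : ∀ P r → Outputs (P ++ o ∷ blockR (suc b) e (negOpt mu)) r →
         Active (P ++ R ∷ replicate b L) (L ∷ gap (suc e) ++ tail) r
  glue P r out = flip-Ls b (gap (suc e) ++ tail)
    (move (step-R-jump P b (gap e ++ tail))
      (subst (λ t → Outputs (P ++ o ∷ t) r) (sym (replicate-++-∷ (suc b) R (gap e ++ tail))) out))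

sweepL-slide : ∀ e u u′ b mu → length u ≡ suc (length u′) →
               SweepL e u 0 (just u′) → SweepL (suc e) (neg u′) b mu → SweepL (suc e) u (suc b) mu
sweepL-slide e u u′ b mu |u| S₀ S₂ = o-then-L S₀ S₂ sameLength (cong suc (trans |u| (cong suc (sym (length-neg u′)))))
  λ P r out → move (step-L-slide P (gap e ++ L ∷ neg u′)) out
  where
  sameLength : suc (e + suc (length (neg u′))) ≡ e + suc (length u)
  sameLength = trans (sym (+-suc e (suc (length (neg u′))))) (cong (λ n → e + suc n) (trans (cong suc (length-neg u′)) (sym |u|)))

sweepL-jump : ∀ e u c mu {w} → NoEmpty w → suc (c + optLength mu) ≡ length u →
              SweepL e u (suc c) mu → SweepR c (suc e) (negOpt mu) w → SweepL (suc e) u 0 (just w)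
sweepL-jump e u c mu {w} noW |u| S₀ S₂ =
  reroute (o-then-L S₀ S₂ sameLength (cong suc (sym K))
             λ P r out → move (step-L-jump P c (gap e ++ optTail L (negOpt mu))) out)
    λ P r act → pass-back refl (λ ()) (gap-allEmpty (suc e))
      (step-R-blocked (P ++ L ∷ gap (suc e)) (neg w) (noEmpty-neg noW))
      (subst (λ X → Active X (L ∷ gap (suc e) ++ L ∷ neg w) r) (++-identityʳ P) act)
  where
  K : suc (c + optLength (negOpt mu)) ≡ length u
  K = trans (cong (λ n → suc (c + n)) (optLength-neg mu)) |u|
  sameLength : suc (e + suc (c + optLength (negOpt mu))) ≡ e + suc (length u)
  sameLength = trans (sym (+-suc e _)) (cong (λ n → e + suc n) K)

-- Duality

-- In both, the second sweep starts at the negative of the end of the first and ends at the negative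
-- of its start.
DualR : ℕ → ℕ → Maybe (List Cell) → Set
DualR a e mu = Σ[ w ∈ List Cell ]
  NoEmpty w × length w ≡ a + optLength mu × SweepR a e mu w × SweepL e (neg w) a (negOpt mu)

DualL : ℕ → List Cell → Set
DualL e u = Σ[ b ∈ ℕ ] Σ[ mu ∈ Maybe (List Cell) ]
  OptNoEmpty mu × b + optLength mu ≡ length u × SweepL e u b mu × SweepR b e (negOpt mu) (neg u)

DualityOfSize : ℕ → Set
DualityOfSize n = (∀ a e mu → OptNoEmpty mu → e + suc (a + optLength mu) ≡ n → DualR a e mu)
                × (∀ e u → NoEmpty u → e + suc (length u) ≡ n → DualL e u)

optNoEmpty-neg : ∀ mu → OptNoEmpty mu → OptNoEmpty (negOpt mu)
optNoEmpty-neg nothing  _   = tt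
optNoEmpty-neg (just u) noU = noEmpty-neg noU

negOpt-involutive : ∀ mu → negOpt (negOpt mu) ≡ mu
negOpt-involutive nothing  = refl
negOpt-involutive (just u) = cong just (neg-involutive u)

neg-optTail : ∀ c mu → neg (optTail c mu) ≡ optTail (flip c) (negOpt mu)
neg-optTail c nothing  = refl
neg-optTail c (just u) = refl

neg-replicate-++ : ∀ n c mu → neg (replicate n c ++ optTail (flip c) mu) ≡ replicate n (flip c) ++ optTail c (negOpt mu)
neg-replicate-++ n c mu = trans (map-++ flip (replicate n c) (optTail (flip c) mu))
  (cong₂ _++_ (map-replicate flip n c)
    (trans (neg-optTail (flip c) mu) (cong (λ d → optTail d (negOpt mu)) (flip-involutive c))))
  where
  flip-involutive : ∀ c → flip (flip c) ≡ c
  flip-involutive o = refl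
  flip-involutive L = refl
  flip-involutive R = refl

split-leading-Ls : ∀ u → NoEmpty u → Σ[ b ∈ ℕ ] Σ[ mu ∈ Maybe (List Cell) ]
            u ≡ replicate b L ++ optTail R mu × OptNoEmpty mu × b + optLength mu ≡ length u
split-leading-Ls []      []         = 0 , nothing , refl , tt , refl
split-leading-Ls (o ∷ u) (o≢o ∷ _)  = contradiction refl o≢o
split-leading-Ls (L ∷ u) (_ ∷ noU) with split-leading-Ls u noU
... | b , mu , refl , noMu , |u| = suc b , mu , refl , noMu , cong suc |u|
split-leading-Ls (R ∷ u) (_ ∷ noU) = 0 , just u , refl , noU , refl

dualR-step : ∀ {n} → DualityOfSize n → ∀ a e mu → OptNoEmpty mu → e + suc (a + optLength mu) ≡ suc n → DualR a e mu
dualR-step _ a zero mu noMu _ =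
  replicate a R ++ optTail L mu , noEmpty-replicate-optTail a (λ ()) (λ ()) mu noMu , length-replicate-optTail a R L mu ,
  sweepR-full a mu noMu ,
  subst (λ u → SweepL 0 u a (negOpt mu)) (sym (neg-replicate-++ a R mu)) (sweepL-full a (negOpt mu) (optNoEmpty-neg mu noMu))
dualR-step ih zero (suc e) nothing _ size with proj₁ ih 0 e nothing tt (suc-injective size)
... | [] , _ , _ , SR , SL = [] , [] , refl , sweepR-lone e SR , sweepL-lone e SL
dualR-step ih (suc a) (suc e) mu noMu size
  with proj₁ ih a (suc e) mu noMu (trans (sym (+-suc e (suc (a + optLength mu)))) (suc-injective size))
... | w₁ , noW₁ , |w₁| , SR₁ , SL₁
  with proj₁ ih 0 e (just (neg w₁)) (noEmpty-neg noW₁)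
         (suc-injective (trans (cong (λ m → suc (e + suc (suc m))) (trans (length-neg w₁) |w₁|)) size))
... | w₂ , noW₂ , |w₂| , SR₂ , SL₂ =
  w₂ , noW₂ , |w₂|′ , sweepR-slide a e mu noW₁ |w₁| SR₁ SR₂ ,
  sweepL-slide e (neg w₂) w₁ a (negOpt mu) (trans (length-neg w₂) (trans |w₂| (cong suc (length-neg w₁))))
    (subst (λ u → SweepL e (neg w₂) 0 (just u)) (neg-involutive w₁) SL₂) SL₁
  where
  |w₂|′ : length w₂ ≡ suc (a + optLength mu)
  |w₂|′ = trans |w₂| (cong suc (trans (length-neg w₁) |w₁|))
dualR-step ih zero (suc e) (just u) noU size
  with proj₂ ih (suc e) u noU (trans (sym (+-suc e (suc (length u)))) (suc-injective size))
... | b , mu , noMu , b+|mu| , SL₁ , SR₁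
  with proj₁ ih (suc b) e (negOpt mu) (optNoEmpty-neg mu noMu)
         (trans (cong (λ m → e + suc (suc m)) (trans (cong (b +_) (optLength-neg mu)) b+|mu|)) (suc-injective size))
... | w₂ , noW₂ , |w₂| , SR₂ , SL₂ =
  w₂ , noW₂ , |w₂|′ , sweepR-jump e u b mu b+|mu| SL₁ SR₂ ,
  sweepL-jump e (neg w₂) b mu (noEmpty-neg noU)
    (sym (trans (length-neg w₂) (trans |w₂| (cong (λ m → suc (b + m)) (optLength-neg mu)))))
    (subst (SweepL e (neg w₂) (suc b)) (negOpt-involutive mu) SL₂) SR₁
  where
  |w₂|′ : length w₂ ≡ suc (length u)
  |w₂|′ = trans |w₂| (cong suc (trans (cong (b +_) (optLength-neg mu)) b+|mu|))

dualL-step : ∀ {n} → DualityOfSize n → ∀ e u → NoEmpty u → e + suc (length u) ≡ suc n → DualL e u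
dualL-step _ zero u noU _ with split-leading-Ls u noU
... | b , mu , refl , noMu , b+|mu| =
  b , mu , noMu , b+|mu| , sweepL-full b mu noMu ,
  subst (SweepR b 0 (negOpt mu)) (sym (neg-replicate-++ b L mu)) (sweepR-full b (negOpt mu) (optNoEmpty-neg mu noMu))
dualL-step ih (suc e) u noU size with proj₂ ih e u noU (suc-injective size)
dualL-step ih (suc e) [] noU size | zero , nothing , _ , _ , SL , SR =
  0 , nothing , tt , refl , sweepL-lone e SL , sweepR-lone e SR
dualL-step ih (suc e) u noU size | zero , just u′ , noU′ , |u| , SL₁ , SR₁
  with proj₂ ih (suc e) (neg u′) (noEmpty-neg noU′)
         (trans (sym (+-suc e (suc (length (neg u′))))) (trans (cong (λ m → e + suc (suc m)) (length-neg u′))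
           (trans (cong (λ m → e + suc m) |u|) (suc-injective size))))
... | b , mu , noMu , b+|mu| , SL₂ , SR₂ =
  suc b , mu , noMu , trans (cong suc (trans b+|mu| (length-neg u′))) |u| ,
  sweepL-slide e u u′ b mu (sym |u|) SL₁ SL₂ ,
  sweepR-slide b e (negOpt mu) noU′ (sym (trans (cong (b +_) (optLength-neg mu)) (trans b+|mu| (length-neg u′))))
    (subst (SweepR b (suc e) (negOpt mu)) (neg-involutive u′) SR₂) SR₁
dualL-step ih (suc e) u noU size | suc c , mu , noMu , |u| , SL₁ , SR₁
  with proj₁ ih c (suc e) (negOpt mu) (optNoEmpty-neg mu noMu)
         (trans (sym (+-suc e (suc (c + optLength (negOpt mu)))))
           (trans (cong (λ m → e + suc (suc (c + m))) (optLength-neg mu))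
             (trans (cong (λ m → e + suc m) |u|) (suc-injective size))))
... | w , noW , |w| , SR₂ , SL₂ =
  0 , just w , noW , trans (cong suc (trans |w| (cong (c +_) (optLength-neg mu)))) |u| ,
  sweepL-jump e u c mu noW |u| SL₁ SR₂ ,
  sweepR-jump e (neg w) c mu (trans (sym (trans |w| (cong (c +_) (optLength-neg mu)))) (sym (length-neg w)))
    (subst (SweepL (suc e) (neg w) c) (negOpt-involutive mu) SL₂) SR₁

duality : ∀ n → DualityOfSize n
duality zero    = (λ a e mu _ size → absurd (trans (sym (+-suc e _)) size)) ,
                  (λ e u _ size → absurd (trans (sym (+-suc e _)) size))
  where
  absurd : ∀ {A : Set} {m} → suc m ≡ 0 → A
  absurd ()
duality (suc n) = dualR-step (duality n) , dualL-step (duality n)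

sweep-from-start : ∀ {T n k end Eˡ Eʳ} (S : Sweep T n k end Eˡ Eʳ) → Active Eˡ Eʳ [] → Outputs T (outs S)
sweep-from-start {T} S halts = subst (Outputs T) (trans (++-identityʳ _) (map-id (outs S))) (run S [] [] halts)

mainTheorem2 : (n k : ℕ) → 1 ≤ k → k ≤ n →
    Σ[ outs ∈ List (List Cell) ]
      RunsTo (replicate k R ++ replicate (n ∸ k) o) outs
      × AllPlacementsOnce n k outs
      × Σ[ w ∈ List Cell ]
          ((All (λ c → c ≢ o) w) × (length w ≡ k ∸ 1)
           × (last outs ≡ just (replicate (n ∸ k) o ++ (R ∷ w)))
           × Σ[ outs′ ∈ List (List Cell) ]
               (RunsTo (neg (replicate (n ∸ k) o ++ (R ∷ w))) outs′
                × AllPlacementsOnce n k outs′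
                × (last outs′ ≡ just (replicate k L ++ replicate (n ∸ k) o))))
mainTheorem2 n (suc a) (s≤s _) k≤n with proj₁ (duality _) a (n ∸ suc a) nothing tt refl
... | w , noW , |w| , SR , SL =
  outs SR ,
  outputs⇒RunsTo (subst (λ T → Outputs T (outs SR)) (cong (replicate (suc a) R ++_) (++-identityʳ (gap e)))
    (sweep-from-start SR (gap-halt e (noEmpty-neg noW)))) ,
  resized (+-identityʳ a) (enumerates SR) ,
  w , noW , trans |w| (+-identityʳ a) , ends SR ,
  outs SL ,
  outputs⇒RunsTo (subst (λ T → Outputs T (outs SL)) (sym negEnd) (sweep-from-start SL (leading-Ls-halt a (gap e ++ [])))) ,
  resized (trans (length-neg w) (trans |w| (+-identityʳ a))) (enumerates SL) ,
  trans (ends SL) (cong (λ t → just (L ∷ replicate a L ++ t)) (++-identityʳ (gap e)))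
  where
  e = n ∸ suc a
  resized : ∀ {m bs} → m ≡ a → Enumerates (e + suc m) (suc m) bs → Enumerates n (suc a) bs
  resized refl = subst (λ n′ → Enumerates n′ (suc a) _) (m∸n+n≡m k≤n)
  negEnd : neg (gap e ++ R ∷ w) ≡ blockL e (neg w)
  negEnd = trans (map-++ flip (gap e) (R ∷ w)) (cong (_++ L ∷ neg w) (map-replicate flip e o))
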